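{- Let $\mathbf P=(P,\leq,{}',0,1)$ be a poset with complementation such that its Dedekind-MacNeille completion $\mathrm{DM}(\mathbf P)$ is an orthomodular lattice. Then $\mathbf P$ is pseudo-orthomodular.
   Context: For $M\subseteq P$, $U(M)$, $L(M)$ denote the sets of upper and lower bounds of $M$ in $P$. A poset with complementation is a bounded poset with a unary operation $'$ which is an antitone involution ($x\leq y\Rightarrow y'\leq x'$, $x''=x$) such that $L(x,x')=\{0\}$ and $U(x,x')=\{1\}$. It is pseudo-orthomodular if $L(U(L(x,y),y'),y)=L(x,y)$ for all $x,y\in P$ (equivalently $U(L(U(x,y),y'),y)=U(x,y)$). The Dedekind-MacNeille completion $\mathrm{DM}(\mathbf P)$ is the complete lattice $(\{B\subseteq P\mid L(U(B))=B\},\subseteq)$, with $P$ embedded via $x\mapsto L(x)$ and with complementation $X\mapsto L(\{x'\mid x\in X\})$. An orthomodular lattice is a lattice with complementation satisfying $x\vee y=((x\vee y)\wedge y')\vee y$. -}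

module Defs where

open import Level using (Level; _⊔_; suc)
open import Data.Product using (Σ; _×_; ∃-syntax)
open import Relation.Unary using (Pred; _∈_; _⊆_; _≐_; _∪_; _∩_; U)
open import Relation.Binary.Bundles using (Poset)

record PosetWithComplementation (c ℓ₁ ℓ₂ : Level) : Set (suc (c ⊔ ℓ₁ ⊔ ℓ₂)) where
  field
    poset : Poset c ℓ₁ ℓ₂
  open Poset poset public
  field
    𝟘 𝟙       : Carrier
    𝟘-least   : ∀ x → 𝟘 ≤ x
    𝟙-greatest : ∀ x → x ≤ 𝟙
    _′        : Carrier → Carrier
    antitone  : ∀ {x y} → x ≤ y → y ′ ≤ x ′
    involutive : ∀ x → (x ′) ′ ≈ x
    compl-L   : ∀ x z → z ≤ x → z ≤ x ′ → z ≈ 𝟘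
    compl-U   : ∀ x z → x ≤ z → x ′ ≤ z → z ≈ 𝟙

module PWC {c ℓ₁ ℓ₂} (𝐏 : PosetWithComplementation c ℓ₁ ℓ₂) where
  open PosetWithComplementation 𝐏

  σ : Level
  σ = c ⊔ ℓ₁ ⊔ ℓ₂

  Sub : Set (suc σ)
  Sub = Pred Carrier σ

  Up : ∀ {ℓ} → Pred Carrier ℓ → Pred Carrier (c ⊔ ℓ ⊔ ℓ₂)
  Up M u = ∀ m → m ∈ M → m ≤ u

  Lo : ∀ {ℓ} → Pred Carrier ℓ → Pred Carrier (c ⊔ ℓ ⊔ ℓ₂)
  Lo M l = ∀ m → m ∈ M → l ≤ m

  ⟦_⟧ : Carrier → Pred Carrier ℓ₁
  ⟦ a ⟧ z = z ≈ a

  ⟦_,_⟧ : Carrier → Carrier → Pred Carrier ℓ₁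
  ⟦ a , b ⟧ = ⟦ a ⟧ ∪ ⟦ b ⟧

  PseudoOrthomodular : Set σ
  PseudoOrthomodular =
    ∀ x y → Lo (Up (Lo ⟦ x , y ⟧ ∪ ⟦ y ′ ⟧) ∪ ⟦ y ⟧) ≐ Lo ⟦ x , y ⟧

  -- Dedekind-MacNeille completion DM(P): subsets B with L(U(B)) = B,
  -- ordered by inclusion.
  IsDM : Sub → Set σ
  IsDM B = Lo (Up B) ≐ B

  _⊓_ : Sub → Sub → Sub
  X ⊓ Y = X ∩ Y

  _⊔ᴰ_ : Sub → Sub → Sub
  X ⊔ᴰ Y = Lo (Up (X ∪ Y))

  ⊥ᴰ ⊤ᴰ : Sub
  ⊥ᴰ = Lo ⟦ 𝟘 ⟧
  ⊤ᴰ = Lo ⟦ 𝟙 ⟧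

  compl : Sub → Sub
  compl X = Lo (λ z → ∃[ x ] (x ∈ X × z ≈ x ′))

  -- DM(P), equipped with the above complementation, is an orthomodular
  -- lattice: the complementation is an antitone involution with
  -- X ∧ X' = 0, X ∨ X' = 1, and the orthomodular law holds.
  -- (DM(P) is always a complete lattice with the operations above.)
  record DMIsOrthomodular : Set (suc σ) where
    field
      compl-antitone : ∀ X Y → IsDM X → IsDM Y → X ⊆ Y → compl Y ⊆ compl X
      compl-involutive : ∀ X → IsDM X → compl (compl X) ≐ X
      compl-meet : ∀ X → IsDM X → (X ⊓ compl X) ≐ ⊥ᴰ
      compl-join : ∀ X → IsDM X → (X ⊔ᴰ compl X) ≐ ⊤ᴰ
      orthomodular : ∀ X Y → IsDM X → IsDM Y →
        (X ⊔ᴰ Y) ≐ (((X ⊔ᴰ Y) ⊓ compl Y) ⊔ᴰ Y)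

module Submission where

-- Fix x, y in P and put A = L(x,y), B = L(y); both are
-- elements of DM(P) and A ⊆ B, hence B' ⊆ A'.  In an orthomodular
-- lattice, whenever Y ≤ X we have X = (X ∧ Y') ∨ Y; applied in DM(P) to
-- X = A' and Y = B' (where B'' = B) this says that every upper bound of
-- (A' ∩ B) ∪ B' is an upper bound of A'.  For z ∈ L(U(L(x,y),y'),y) the
-- element z' is such an upper bound: elements of B' lie below y' ≤ z',
-- and for m ∈ A' ∩ B the element m' is an upper bound of L(x,y) ∪ {y'},
-- so z ≤ m'.  Thus z' bounds A', i.e. z ∈ A'' = A = L(x,y).  The reverse
-- inclusion L(x,y) ⊆ L(U(L(x,y),y'),y) is immediate.

open import Defs
-- the pair constructor is renamed so that it does not clash with ⟦_,_⟧
open import Data.Product using (proj₁) renaming (_,_ to _&_)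
open import Data.Sum using (inj₁; inj₂)
open import Relation.Unary using (_⊆_; _∪_; _∈_; Pred; _≐_)

module _ {c ℓ₁ ℓ₂} (𝐏 : PosetWithComplementation c ℓ₁ ℓ₂) where
  open PosetWithComplementation 𝐏
  open PWC 𝐏

  Lo-closed : ∀ {ℓ} (M : Pred Carrier ℓ) → Lo (Up (Lo M)) ≐ Lo M
  Lo-closed M = (λ z∈LUL m m∈M → z∈LUL m (λ l l∈LM → l∈LM m m∈M))
              & (λ z∈LM u u∈ULM → u∈ULM _ z∈LM)

  join-below : ∀ {X Y : Sub} {m u} → m ∈ (X ⊔ᴰ Y) → u ∈ Up (X ∪ Y) → m ≤ u
  join-below m∈X⊔Y u∈U = m∈X⊔Y _ u∈U

  ⊆-join : ∀ {X Y : Sub} → X ⊆ (X ⊔ᴰ Y)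
  ⊆-join w∈X u u∈U = u∈U _ (inj₁ w∈X)

  join-absorb : ∀ {X Y : Sub} → IsDM X → Y ⊆ X → (X ⊔ᴰ Y) ⊆ X
  join-absorb closed Y⊆X m∈X⊔Y =
    proj₁ closed (λ u u∈UX → join-below m∈X⊔Y λ
      { k (inj₁ k∈X) → u∈UX k k∈X
      ; k (inj₂ k∈Y) → u∈UX k (Y⊆X k∈Y) })

  compl-elim : ∀ {X : Sub} {m x} → m ∈ compl X → x ∈ X → m ≤ x ′
  compl-elim m∈X' x∈X = m∈X' _ (_ & x∈X & Eq.refl)

  compl-intro : ∀ {X : Sub} {z} → (∀ x → x ∈ X → z ≤ x ′) → z ∈ compl X
  compl-intro below k (x & x∈X & k≈x′) = trans (below x x∈X) (reflexive (Eq.sym k≈x′))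

  flip : ∀ {a b} → a ≤ b ′ → b ≤ a ′
  flip {b = b} a≤b′ = trans (reflexive (Eq.sym (involutive b))) (antitone a≤b′)

  compl-from-Up : ∀ {X : Sub} {z} → z ′ ∈ Up X → z ∈ compl X
  compl-from-Up z′∈UX = compl-intro λ x x∈X → flip (z′∈UX x x∈X)

  y∈L[y] : ∀ y → y ∈ Lo ⟦ y ⟧
  y∈L[y] y k k≈y = reflexive (Eq.sym k≈y)

  L[x,y]≤y : ∀ x y {z} → z ∈ Lo ⟦ x , y ⟧ → z ≤ y
  L[x,y]≤y x y z∈A = z∈A y (inj₂ Eq.refl)

  L[x,y]⊆L[y] : ∀ x y → Lo ⟦ x , y ⟧ ⊆ Lo ⟦ y ⟧
  L[x,y]⊆L[y] x y z∈A k k≈y = trans (L[x,y]≤y x y z∈A) (reflexive (Eq.sym k≈y))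

  Lo-pair-⊆ : ∀ x y → Lo ⟦ x , y ⟧ ⊆ Lo (Up (Lo ⟦ x , y ⟧ ∪ ⟦ y ′ ⟧) ∪ ⟦ y ⟧)
  Lo-pair-⊆ x y z∈A u (inj₁ u∈U) = u∈U _ (inj₁ z∈A)
  Lo-pair-⊆ x y z∈A u (inj₂ u≈y) = trans (L[x,y]≤y x y z∈A) (reflexive (Eq.sym u≈y))

  -- If z ∈ L(U(L(x,y),y'),y), then every m ∈ L(x,y)' with m ≤ y lies
  -- below z', because m' is an upper bound of L(x,y) ∪ {y'}.
  below-complement : ∀ x y {z m} → z ∈ Lo (Up (Lo ⟦ x , y ⟧ ∪ ⟦ y ′ ⟧) ∪ ⟦ y ⟧) →
    m ∈ compl (Lo ⟦ x , y ⟧) → m ≤ y → m ≤ z ′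
  below-complement x y {m = m} z∈LHS m∈A′ m≤y = flip (z∈LHS (m ′) (inj₁ m′∈U))
    where
    m′∈U : m ′ ∈ Up (Lo ⟦ x , y ⟧ ∪ ⟦ y ′ ⟧)
    m′∈U t (inj₁ t∈A) = flip (compl-elim m∈A′ t∈A)
    m′∈U t (inj₂ t≈y′) = trans (reflexive t≈y′) (antitone m≤y)

  module _ (DM : DMIsOrthomodular) where
    open DMIsOrthomodular DM

    -- Orthomodularity of DM(P) in the form "Y ≤ X implies
    -- X = (X ∧ Y') ∨ Y": every upper bound of (X ∩ Y') ∪ Y bounds X.
    orthomodular-generation : ∀ X Y → IsDM X → IsDM Y → Y ⊆ X →
      ∀ {u} → u ∈ Up ((X ⊓ compl Y) ∪ Y) → u ∈ Up X
    orthomodular-generation X Y closedX closedY Y⊆X {u} u∈U w w∈X =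
      join-below (proj₁ (orthomodular X Y closedX closedY) (⊆-join w∈X)) bound
      where
      bound : u ∈ Up (((X ⊔ᴰ Y) ⊓ compl Y) ∪ Y)
      bound m (inj₁ (m∈X⊔Y & m∈Y')) = u∈U m (inj₁ (join-absorb closedX Y⊆X m∈X⊔Y & m∈Y'))
      bound m (inj₂ m∈Y) = u∈U m (inj₂ m∈Y)

    -- The inclusion L(U(L(x,y),y'),y) ⊆ L(x,y) is where orthomodularity
    -- is used: with A = L(x,y) and B = L(y), z' bounds A' ∩ B'' and B'.
    pseudo-orthomodular : PseudoOrthomodular
    pseudo-orthomodular x y = reduce & Lo-pair-⊆ x y
      where
      A B : Sub
      A = Lo ⟦ x , y ⟧
      B = Lo ⟦ y ⟧

      reduce : Lo (Up (A ∪ ⟦ y ′ ⟧) ∪ ⟦ y ⟧) ⊆ A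
      reduce {z} z∈LHS = proj₁ (compl-involutive A (Lo-closed _)) (compl-from-Up z′∈UA′)
        where
        z≤y : z ≤ y
        z≤y = z∈LHS y (inj₂ Eq.refl)

        z′∈U : z ′ ∈ Up ((compl A ⊓ compl (compl B)) ∪ compl B)
        z′∈U m (inj₁ (m∈A′ & m∈B″)) =
          below-complement x y z∈LHS m∈A′ (proj₁ (compl-involutive B (Lo-closed _)) m∈B″ y Eq.refl)
        z′∈U m (inj₂ m∈B′) = trans (compl-elim m∈B′ (y∈L[y] y)) (antitone z≤y)

        z′∈UA′ : z ′ ∈ Up (compl A)
        z′∈UA′ = orthomodular-generation (compl A) (compl B) (Lo-closed _) (Lo-closed _)
          (compl-antitone A B (Lo-closed _) (Lo-closed _) (L[x,y]⊆L[y] x y)) z′∈U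

theorem4 : ∀ {c ℓ₁ ℓ₂} (𝐏 : PosetWithComplementation c ℓ₁ ℓ₂) →
    PWC.DMIsOrthomodular 𝐏 → PWC.PseudoOrthomodular 𝐏
theorem4 𝐏 DM = pseudo-orthomodular 𝐏 DM
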